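{- Let $\mathcal{L}$ be a unimodal signature and let $\mathcal{F}$ be a minimally generated $\mathcal{L}$-modal frame. Then $\mathcal{F}$ is an $\mathcal{L}$-unimodal frame if and only if $\mathcal{F}$ satisfies the frame condition $(\Delta_\alpha,\nabla_\beta)$ for every labelled pair $(\Delta_\alpha,\nabla_\beta)$ in the list below with $\Delta_\alpha,\nabla_\beta\in\mathcal{L}$.
   Context: Modal symbols: $\Box_{+},\Box_{ - },\Diamond_{+},\Diamond_{ - }$; a unimodal signature $\mathcal{L}$ is a subset of these. For relations $S,T$, $x\,(S\circ T)\,z$ iff $xSy$ and $yTz$ for some $y$. On a poset $(W,\leq)$, $R\subseteq W\times W$ is a $\Box_{+}$-relation if ${\leq}\circ R\circ{\leq}\subseteq R$, a $\Box_{ - }$-relation if ${\leq}\circ R\circ{\geq}\subseteq R$, a $\Diamond_{+}$-relation if ${\geq}\circ R\circ{\geq}\subseteq R$, a $\Diamond_{ - }$-relation if ${\geq}\circ R\circ{\leq}\subseteq R$; for any $R$ let $\Box_{+}[R]={\leq}\circ R\circ{\leq}$, $\Box_{ - }[R]={\leq}\circ R\circ{\geq}$, $\Diamond_{+}[R]={\geq}\circ R\circ{\geq}$, $\Diamond_{ - }[R]={\geq}\circ R\circ{\leq}$. An $\mathcal{L}$-modal frame is a poset $(W,\leq)$ with a $\Delta_\alpha$-relation $R^{\Delta}_{\alpha}$ for each $\Delta_\alpha\in\mathcal{L}$; it is $\mathcal{L}$-unimodal if there is $R\subseteq W\times W$ with $R^{\Delta}_{\alpha}=\Delta_\alpha[R]$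 for all $\Delta_\alpha\in\mathcal{L}$. Minimal generation: a subset $X$ of a poset $(P,\preceq)$ is minimally generated if for each $x\in X$ the set $\{y\in X: y\preceq x\}$ has a minimal element. A $\Delta_\alpha$-relation is minimally generated if it is minimally generated as a subset of the product poset $P_{\Delta_\alpha}$, where $P_{\Box_{+}}=(W,\geq)\times(W,\leq)$, $P_{\Box_{ - }}=(W,\geq)\times(W,\geq)$, $P_{\Diamond_{+}}=(W,\leq)\times(W,\geq)$, $P_{\Diamond_{ - }}=(W,\leq)\times(W,\leq)$. An $\mathcal{L}$-modal frame is minimally generated if each of its relations $R^{\Delta}_{\alpha}$ is. Frame conditions: $(\Box_{+},\Box_{ - })$: $R^{\Box}_{+}\subseteq(R^{\Box}_{+}\cap R^{\Box}_{ - })\circ{\leq}$; $(\Box_{ - },\Box_{+})$: $R^{\Box}_{ - }\subseteq(R^{\Box}_{ - }\cap R^{\Box}_{+})\circ{\geq}$; $(\Diamond_{+},\Diamond_{ - })$: $R^{\Diamond}_{+}\subseteq(R^{\Diamond}_{+}\cap R^{\Diamond}_{ - })\circ{\geq}$; $(\Diamond_{ - },\Diamond_{+})$: $R^{\Diamond}_{ - }\subseteq(R^{\Diamond}_{ - }\cap R^{\Diamond}_{+})\circ{\leq}$; $(\Box_{+},\Diamond_{ - })$: $R^{\Box}_{+}\subseteq{\leq}\circ(R^{\Box}_{+}\cap R^{\Diamond}_{ - })$; $(\Box_{ - },\Diamond_{+})$: $R^{\Box}_{ - }\subseteq{\leq}\circ(R^{\Box}_{ - }\cap R^{\Diamond}_{+})$;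 $(\Diamond_{+},\Box_{ - })$: $R^{\Diamond}_{+}\subseteq{\geq}\circ(R^{\Diamond}_{+}\cap R^{\Box}_{ - })$; $(\Diamond_{ - },\Box_{+})$: $R^{\Diamond}_{ - }\subseteq{\geq}\circ(R^{\Diamond}_{ - }\cap R^{\Box}_{+})$; $(\Box_{+},\Diamond_{+})$: if $uR^{\Box}_{+}v$ then there are $u'\geq u$, $v'\leq v$ with $u'R^{\Box}_{+}v$, $uR^{\Box}_{+}v'$, $u'R^{\Diamond}_{+}v'$; $(\Box_{ - },\Diamond_{ - })$: if $uR^{\Box}_{ - }v$ then there are $u'\geq u$, $v'\geq v$ with $u'R^{\Box}_{ - }v$, $uR^{\Box}_{ - }v'$, $u'R^{\Diamond}_{ - }v'$; $(\Diamond_{+},\Box_{+})$: if $uR^{\Diamond}_{+}v$ then there are $u'\leq u$, $v'\geq v$ with $u'R^{\Diamond}_{+}v$, $uR^{\Diamond}_{+}v'$, $u'R^{\Box}_{+}v'$; $(\Diamond_{ - },\Box_{ - })$: if $uR^{\Diamond}_{ - }v$ then there are $u'\leq u$, $v'\leq v$ with $u'R^{\Diamond}_{ - }v$, $uR^{\Diamond}_{ - }v'$, $u'R^{\Box}_{ - }v'$. -}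

module Defs where

open import Level using (Level; _⊔_)
open import Data.Bool using (Bool; T)
open import Data.Product using (Σ; ∃; ∃-syntax; _×_; _,_)
open import Relation.Binary.Core using (Rel)
open import Relation.Binary.Bundles using (Poset)
open import Function using (flip)

data Mod : Set where
  □₊ □₋ ◇₊ ◇₋ : Mod

Signature : Set
Signature = Mod → Bool

_⨾_ : ∀ {a ℓ₁ ℓ₂} {A : Set a} → Rel A ℓ₁ → Rel A ℓ₂ → Rel A (a ⊔ ℓ₁ ⊔ ℓ₂)
(S ⨾ T) x z = ∃[ y ] (S x y × T y z)

_∩_ : ∀ {a ℓ₁ ℓ₂} {A : Set a} → Rel A ℓ₁ → Rel A ℓ₂ → Rel A (ℓ₁ ⊔ ℓ₂)
(S ∩ T) x y = S x y × T x y

_⊆ᵣ_ : ∀ {a ℓ₁ ℓ₂} {A : Set a} → Rel A ℓ₁ → Rel A ℓ₂ → Set (a ⊔ ℓ₁ ⊔ ℓ₂)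
S ⊆ᵣ T = ∀ x y → S x y → T x y

_≐_ : ∀ {a ℓ₁ ℓ₂} {A : Set a} → Rel A ℓ₁ → Rel A ℓ₂ → Set (a ⊔ ℓ₁ ⊔ ℓ₂)
S ≐ T = (S ⊆ᵣ T) × (T ⊆ᵣ S)

module OnPoset {c ℓ₁ ℓ₂} (P : Poset c ℓ₁ ℓ₂) where
  open Poset P renaming (Carrier to W)

  -- Left and right order used in Δ[R] = leftOrd Δ ∘ R ∘ rightOrd Δ:
  -- □₊[R] = ≤∘R∘≤, □₋[R] = ≤∘R∘≥, ◇₊[R] = ≥∘R∘≥, ◇₋[R] = ≥∘R∘≤.
  leftOrd : Mod → Rel W ℓ₂
  leftOrd □₊ = _≤_
  leftOrd □₋ = _≤_
  leftOrd ◇₊ = _≥_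
  leftOrd ◇₋ = _≥_

  rightOrd : Mod → Rel W ℓ₂
  rightOrd □₊ = _≤_
  rightOrd □₋ = _≥_
  rightOrd ◇₊ = _≥_
  rightOrd ◇₋ = _≤_

  _[_] : ∀ {ℓ} → Mod → Rel W ℓ → Rel W (c ⊔ ℓ₂ ⊔ ℓ)
  m [ R ] = (leftOrd m ⨾ R) ⨾ rightOrd m

  IsModRel : ∀ {ℓ} → Mod → Rel W ℓ → Set (c ⊔ ℓ₂ ⊔ ℓ)
  IsModRel m R = (m [ R ]) ⊆ᵣ R

  -- The product poset P_Δ on W × W: first factor order and second factor order.
  -- P_□₊ = (W,≥)×(W,≤), P_□₋ = (W,≥)×(W,≥), P_◇₊ = (W,≤)×(W,≥), P_◇₋ = (W,≤)×(W,≤).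
  fstOrd : Mod → Rel W ℓ₂
  fstOrd □₊ = _≥_
  fstOrd □₋ = _≥_
  fstOrd ◇₊ = _≤_
  fstOrd ◇₋ = _≤_

  sndOrd : Mod → Rel W ℓ₂
  sndOrd □₊ = _≤_
  sndOrd □₋ = _≥_
  sndOrd ◇₊ = _≥_
  sndOrd ◇₋ = _≤_

  _⊢_,_⪯_,_ : Mod → W → W → W → W → Set ℓ₂
  m ⊢ a , b ⪯ x , y = fstOrd m a x × sndOrd m b y

  MinGen : ∀ {ℓ} → Mod → Rel W ℓ → Set (c ⊔ ℓ₁ ⊔ ℓ₂ ⊔ ℓ)
  MinGen m X =
    ∀ x y → X x y →
      ∃[ a ] ∃[ b ] (X a b × (m ⊢ a , b ⪯ x , y) ×
        (∀ a' b' → X a' b' → (m ⊢ a' , b' ⪯ a , b) → (a' ≈ a × b' ≈ b)))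

  record Frame (L : Signature) (ℓ : Level) : Set (c ⊔ ℓ₂ Level.⊔ Level.suc ℓ) where
    field
      rel   : (m : Mod) → T (L m) → Rel W ℓ
      isRel : (m : Mod) (h : T (L m)) → IsModRel m (rel m h)

  module _ {L : Signature} {ℓ : Level} (F : Frame L ℓ) where
    open Frame F

    MinimallyGenerated : Set (c ⊔ ℓ₁ ⊔ ℓ₂ ⊔ ℓ)
    MinimallyGenerated = (m : Mod) (h : T (L m)) → MinGen m (rel m h)

    Unimodal : Set (c ⊔ ℓ₂ ⊔ Level.suc ℓ)
    Unimodal = Σ (Rel W ℓ) λ R → (m : Mod) (h : T (L m)) → rel m h ≐ (m [ R ])

  data Pair : Set where
    □₊□₋ □₋□₊ ◇₊◇₋ ◇₋◇₊ □₊◇₋ □₋◇₊ ◇₊□₋ ◇₋□₊ □₊◇₊ □₋◇₋ ◇₊□₊ ◇₋□₋ : Pair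

  first : Pair → Mod
  first □₊□₋ = □₊
  first □₋□₊ = □₋
  first ◇₊◇₋ = ◇₊
  first ◇₋◇₊ = ◇₋
  first □₊◇₋ = □₊
  first □₋◇₊ = □₋
  first ◇₊□₋ = ◇₊
  first ◇₋□₊ = ◇₋
  first □₊◇₊ = □₊
  first □₋◇₋ = □₋
  first ◇₊□₊ = ◇₊
  first ◇₋□₋ = ◇₋

  second : Pair → Mod
  second □₊□₋ = □₋
  second □₋□₊ = □₊
  second ◇₊◇₋ = ◇₋
  second ◇₋◇₊ = ◇₊
  second □₊◇₋ = ◇₋
  second □₋◇₊ = ◇₊
  second ◇₊□₋ = □₋
  second ◇₋□₊ = □₊
  second □₊◇₊ = ◇₊
  second □₋◇₋ = ◇₋
  second ◇₊□₊ = □₊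
  second ◇₋□₋ = □₋

  Condition : ∀ {ℓ} → Pair → Rel W ℓ → Rel W ℓ → Set (c ⊔ ℓ₂ ⊔ ℓ)
  Condition □₊□₋ RΔ R∇ = RΔ ⊆ᵣ ((RΔ ∩ R∇) ⨾ _≤_)
  Condition □₋□₊ RΔ R∇ = RΔ ⊆ᵣ ((RΔ ∩ R∇) ⨾ _≥_)
  Condition ◇₊◇₋ RΔ R∇ = RΔ ⊆ᵣ ((RΔ ∩ R∇) ⨾ _≥_)
  Condition ◇₋◇₊ RΔ R∇ = RΔ ⊆ᵣ ((RΔ ∩ R∇) ⨾ _≤_)
  Condition □₊◇₋ RΔ R∇ = RΔ ⊆ᵣ (_≤_ ⨾ (RΔ ∩ R∇))
  Condition □₋◇₊ RΔ R∇ = RΔ ⊆ᵣ (_≤_ ⨾ (RΔ ∩ R∇))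
  Condition ◇₊□₋ RΔ R∇ = RΔ ⊆ᵣ (_≥_ ⨾ (RΔ ∩ R∇))
  Condition ◇₋□₊ RΔ R∇ = RΔ ⊆ᵣ (_≥_ ⨾ (RΔ ∩ R∇))
  Condition □₊◇₊ RΔ R∇ = ∀ u v → RΔ u v →
    ∃[ u' ] ∃[ v' ] (u ≤ u' × v' ≤ v × RΔ u' v × RΔ u v' × R∇ u' v')
  Condition □₋◇₋ RΔ R∇ = ∀ u v → RΔ u v →
    ∃[ u' ] ∃[ v' ] (u ≤ u' × v ≤ v' × RΔ u' v × RΔ u v' × R∇ u' v')
  Condition ◇₊□₊ RΔ R∇ = ∀ u v → RΔ u v →
    ∃[ u' ] ∃[ v' ] (u' ≤ u × v ≤ v' × RΔ u' v × RΔ u v' × R∇ u' v')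
  Condition ◇₋□₋ RΔ R∇ = ∀ u v → RΔ u v →
    ∃[ u' ] ∃[ v' ] (u' ≤ u × v' ≤ v × RΔ u' v × RΔ u v' × R∇ u' v')

  SatisfiesAllConditions : ∀ {L ℓ} → Frame L ℓ → Set (c ⊔ ℓ₂ ⊔ ℓ)
  SatisfiesAllConditions {L} F =
    (p : Pair) (h₁ : T (L (first p))) (h₂ : T (L (second p))) →
      Condition p (Frame.rel F (first p) h₁) (Frame.rel F (second p) h₂)

-- Soundness: if R^Δ = Δ[R] for every Δ, each condition is witnessed by unfolding a
-- relation to Δ[R] and refolding the middle R-step into the other relations.
-- Completeness: take R to be the intersection of all relations of the frame. A condition
-- (Δ, ∇) moves any pair of R^Δ to a ⪯-smaller pair that also lies in R^∇, so a minimal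
-- pair of R^Δ already lies in R^∇, hence in R. Minimal generation then places every pair
-- of R^Δ above a pair of R, i.e. R^Δ ⊆ Δ[R]; the reverse inclusion holds since R^Δ is a
-- Δ-relation containing R.
module Submission where

open import Defs
open import Level using (Level; _⊔_)
open import Relation.Binary.Core using (Rel)
open import Relation.Binary.Bundles using (Poset)
open import Function.Bundles using (_⇔_; mk⇔)
open import Data.Bool using (T)
open import Data.Bool.Properties using (T-irrelevant)
open import Data.Product using (_×_; _,_)
open import Relation.Binary.PropositionalEquality using (subst)

module _ {c ℓ₁ ℓ₂} (P : Poset c ℓ₁ ℓ₂) where
  open Poset P renaming (Carrier to W)
  open OnPoset P

  private
    ≈⇒≥ : ∀ {x y} → x ≈ y → y ≤ x
    ≈⇒≥ x≈y = reflexive (Eq.sym x≈y)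

  into-image : ∀ {ℓ} m (R : Rel W ℓ) {x a b y} →
               leftOrd m x a → R a b → rightOrd m b y → (m [ R ]) x y
  into-image m R {b = b} x≤a Rab b≤y = b , (_ , x≤a , Rab) , b≤y

  modRel-closed : ∀ {ℓ} m {X : Rel W ℓ} → IsModRel m X → ∀ {x a b y} →
                  leftOrd m x a → X a b → rightOrd m b y → X x y
  modRel-closed m {X} closed x≤a Xab b≤y = closed _ _ (into-image m X x≤a Xab b≤y)

  image-⊆ : ∀ {ℓ ℓ'} m {R : Rel W ℓ} {X : Rel W ℓ'} →
            IsModRel m X → R ⊆ᵣ X → (m [ R ]) ⊆ᵣ X
  image-⊆ m closed R⊆X x y (b , (a , x≤a , Rab) , b≤y) =
    modRel-closed m closed x≤a (R⊆X a b Rab) b≤y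

  conditions-of-images : ∀ {ℓ ℓ'} p (R : Rel W ℓ) {RΔ R∇ : Rel W ℓ'} →
    RΔ ≐ (first p [ R ]) → R∇ ≐ (second p [ R ]) → Condition p RΔ R∇
  conditions-of-images □₊□₋ R (to , from) (_ , from∇) x y r
    with b , (a , x≤a , Rab) , b≤y ← to x y r =
    b , ( from x b (into-image □₊ R x≤a Rab refl)
        , from∇ x b (into-image □₋ R x≤a Rab refl)) , b≤y
  conditions-of-images □₋□₊ R (to , from) (_ , from∇) x y r
    with b , (a , x≤a , Rab) , b≥y ← to x y r =
    b , ( from x b (into-image □₋ R x≤a Rab refl)
        , from∇ x b (into-image □₊ R x≤a Rab refl)) , b≥y
  conditions-of-images ◇₊◇₋ R (to , from) (_ , from∇) x y r
    with b , (a , x≥a , Rab) , b≥y ← to x y r =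
    b , ( from x b (into-image ◇₊ R x≥a Rab refl)
        , from∇ x b (into-image ◇₋ R x≥a Rab refl)) , b≥y
  conditions-of-images ◇₋◇₊ R (to , from) (_ , from∇) x y r
    with b , (a , x≥a , Rab) , b≤y ← to x y r =
    b , ( from x b (into-image ◇₋ R x≥a Rab refl)
        , from∇ x b (into-image ◇₊ R x≥a Rab refl)) , b≤y
  conditions-of-images □₊◇₋ R (to , from) (_ , from∇) x y r
    with b , (a , x≤a , Rab) , b≤y ← to x y r =
    a , x≤a , ( from a y (into-image □₊ R refl Rab b≤y)
            , from∇ a y (into-image ◇₋ R refl Rab b≤y))
  conditions-of-images □₋◇₊ R (to , from) (_ , from∇) x y r
    with b , (a , x≤a , Rab) , b≥y ← to x y r =
    a , x≤a , ( from a y (into-image □₋ R refl Rab b≥y)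
            , from∇ a y (into-image ◇₊ R refl Rab b≥y))
  conditions-of-images ◇₊□₋ R (to , from) (_ , from∇) x y r
    with b , (a , x≥a , Rab) , b≥y ← to x y r =
    a , x≥a , ( from a y (into-image ◇₊ R refl Rab b≥y)
            , from∇ a y (into-image □₋ R refl Rab b≥y))
  conditions-of-images ◇₋□₊ R (to , from) (_ , from∇) x y r
    with b , (a , x≥a , Rab) , b≤y ← to x y r =
    a , x≥a , ( from a y (into-image ◇₋ R refl Rab b≤y)
            , from∇ a y (into-image □₊ R refl Rab b≤y))
  conditions-of-images □₊◇₊ R (to , from) (_ , from∇) x y r
    with b , (a , x≤a , Rab) , b≤y ← to x y r =
    a , b , x≤a , b≤y , from a y (into-image □₊ R refl Rab b≤y) ,
    from x b (into-image □₊ R x≤a Rab refl) , from∇ a b (into-image ◇₊ R refl Rab refl)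
  conditions-of-images □₋◇₋ R (to , from) (_ , from∇) x y r
    with b , (a , x≤a , Rab) , b≥y ← to x y r =
    a , b , x≤a , b≥y , from a y (into-image □₋ R refl Rab b≥y) ,
    from x b (into-image □₋ R x≤a Rab refl) , from∇ a b (into-image ◇₋ R refl Rab refl)
  conditions-of-images ◇₊□₊ R (to , from) (_ , from∇) x y r
    with b , (a , x≥a , Rab) , b≥y ← to x y r =
    a , b , x≥a , b≥y , from a y (into-image ◇₊ R refl Rab b≥y) ,
    from x b (into-image ◇₊ R x≥a Rab refl) , from∇ a b (into-image □₊ R refl Rab refl)
  conditions-of-images ◇₋□₋ R (to , from) (_ , from∇) x y r
    with b , (a , x≥a , Rab) , b≤y ← to x y r =
    a , b , x≥a , b≤y , from a y (into-image ◇₋ R refl Rab b≤y) ,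
    from x b (into-image ◇₋ R x≥a Rab refl) , from∇ a b (into-image □₋ R refl Rab refl)

  IsMinimal : ∀ {ℓ} → Mod → Rel W ℓ → W → W → Set (c ⊔ ℓ₁ ⊔ ℓ₂ ⊔ ℓ)
  IsMinimal m X a b = ∀ a' b' → X a' b' → (m ⊢ a' , b' ⪯ a , b) → (a' ≈ a × b' ≈ b)

  minimal-∈-second : ∀ {ℓ} p {RΔ R∇ : Rel W ℓ} →
    IsModRel (second p) R∇ → Condition p RΔ R∇ →
    ∀ {a b} → RΔ a b → IsMinimal (first p) RΔ a b → R∇ a b
  minimal-∈-second □₊□₋ closed cond {a} {b} r min
    with c , (r₁ , r₂) , c≤b ← cond a b r
    with _ , c≈b ← min a c r₁ (refl , c≤b) =
    modRel-closed □₋ closed refl r₂ (≈⇒≥ c≈b)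
  minimal-∈-second □₋□₊ closed cond {a} {b} r min
    with c , (r₁ , r₂) , c≥b ← cond a b r
    with _ , c≈b ← min a c r₁ (refl , c≥b) =
    modRel-closed □₊ closed refl r₂ (reflexive c≈b)
  minimal-∈-second ◇₊◇₋ closed cond {a} {b} r min
    with c , (r₁ , r₂) , c≥b ← cond a b r
    with _ , c≈b ← min a c r₁ (refl , c≥b) =
    modRel-closed ◇₋ closed refl r₂ (reflexive c≈b)
  minimal-∈-second ◇₋◇₊ closed cond {a} {b} r min
    with c , (r₁ , r₂) , c≤b ← cond a b r
    with _ , c≈b ← min a c r₁ (refl , c≤b) =
    modRel-closed ◇₊ closed refl r₂ (≈⇒≥ c≈b)
  minimal-∈-second □₊◇₋ closed cond {a} {b} r min
    with c , a≤c , (r₁ , r₂) ← cond a b r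
    with c≈a , _ ← min c b r₁ (a≤c , refl) =
    modRel-closed ◇₋ closed (reflexive c≈a) r₂ refl
  minimal-∈-second □₋◇₊ closed cond {a} {b} r min
    with c , a≤c , (r₁ , r₂) ← cond a b r
    with c≈a , _ ← min c b r₁ (a≤c , refl) =
    modRel-closed ◇₊ closed (reflexive c≈a) r₂ refl
  minimal-∈-second ◇₊□₋ closed cond {a} {b} r min
    with c , a≥c , (r₁ , r₂) ← cond a b r
    with c≈a , _ ← min c b r₁ (a≥c , refl) =
    modRel-closed □₋ closed (≈⇒≥ c≈a) r₂ refl
  minimal-∈-second ◇₋□₊ closed cond {a} {b} r min
    with c , a≥c , (r₁ , r₂) ← cond a b r
    with c≈a , _ ← min c b r₁ (a≥c , refl) =
    modRel-closed □₊ closed (≈⇒≥ c≈a) r₂ refl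
  minimal-∈-second □₊◇₊ closed cond {a} {b} r min
    with a' , b' , a≤a' , b'≤b , r₁ , r₂ , r₃ ← cond a b r
    with a'≈a , _ ← min a' b r₁ (a≤a' , refl)
    with _ , b'≈b ← min a b' r₂ (refl , b'≤b) =
    modRel-closed ◇₊ closed (reflexive a'≈a) r₃ (≈⇒≥ b'≈b)
  minimal-∈-second □₋◇₋ closed cond {a} {b} r min
    with a' , b' , a≤a' , b≤b' , r₁ , r₂ , r₃ ← cond a b r
    with a'≈a , _ ← min a' b r₁ (a≤a' , refl)
    with _ , b'≈b ← min a b' r₂ (refl , b≤b') =
    modRel-closed ◇₋ closed (reflexive a'≈a) r₃ (reflexive b'≈b)
  minimal-∈-second ◇₊□₊ closed cond {a} {b} r min
    with a' , b' , a'≤a , b≤b' , r₁ , r₂ , r₃ ← cond a b r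
    with a'≈a , _ ← min a' b r₁ (a'≤a , refl)
    with _ , b'≈b ← min a b' r₂ (refl , b≤b') =
    modRel-closed □₊ closed (≈⇒≥ a'≈a) r₃ (reflexive b'≈b)
  minimal-∈-second ◇₋□₋ closed cond {a} {b} r min
    with a' , b' , a'≤a , b'≤b , r₁ , r₂ , r₃ ← cond a b r
    with a'≈a , _ ← min a' b r₁ (a'≤a , refl)
    with _ , b'≈b ← min a b' r₂ (refl , b'≤b) =
    modRel-closed □₋ closed (≈⇒≥ a'≈a) r₃ (≈⇒≥ b'≈b)

  fstOrd⇒leftOrd : ∀ m {a x} → fstOrd m a x → leftOrd m x a
  fstOrd⇒leftOrd □₊ a≥x = a≥x
  fstOrd⇒leftOrd □₋ a≥x = a≥x
  fstOrd⇒leftOrd ◇₊ a≤x = a≤x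
  fstOrd⇒leftOrd ◇₋ a≤x = a≤x

  sndOrd⇒rightOrd : ∀ m {b y} → sndOrd m b y → rightOrd m b y
  sndOrd⇒rightOrd □₊ b≤y = b≤y
  sndOrd⇒rightOrd □₋ b≥y = b≥y
  sndOrd⇒rightOrd ◇₊ b≥y = b≥y
  sndOrd⇒rightOrd ◇₋ b≤y = b≤y

  minGen-⊆-image : ∀ {ℓ ℓ'} m {X : Rel W ℓ} {R : Rel W ℓ'} → MinGen m X →
    (∀ {a b} → X a b → IsMinimal m X a b → R a b) → X ⊆ᵣ (m [ R ])
  minGen-⊆-image m minGen minimal⇒R x y Xxy
    with _ , _ , Xab , (a≼x , b≼y) , min ← minGen x y Xxy =
    into-image m _ (fstOrd⇒leftOrd m a≼x) (minimal⇒R Xab min) (sndOrd⇒rightOrd m b≼y)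

  module _ {L : Signature} {ℓ : Level} (F : Frame L ℓ) where
    open Frame F

    unimodal⇒conditions : Unimodal F → SatisfiesAllConditions F
    unimodal⇒conditions (R , rel≐image) p h₁ h₂ =
      conditions-of-images p R (rel≐image (first p) h₁) (rel≐image (second p) h₂)

    rel-irrelevant : ∀ m (h h' : T (L m)) → rel m h ⊆ᵣ rel m h'
    rel-irrelevant m h h' x y = subst (λ h → rel m h x y) (T-irrelevant h h')

    minimal-∈-rel : SatisfiesAllConditions F → ∀ m n (hm : T (L m)) (hn : T (L n)) {a b} →
      rel m hm a b → IsMinimal m (rel m hm) a b → rel n hn a b
    minimal-∈-rel sat □₊ □₊ hm hn r _ = rel-irrelevant □₊ hm hn _ _ r
    minimal-∈-rel sat □₋ □₋ hm hn r _ = rel-irrelevant □₋ hm hn _ _ r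
    minimal-∈-rel sat ◇₊ ◇₊ hm hn r _ = rel-irrelevant ◇₊ hm hn _ _ r
    minimal-∈-rel sat ◇₋ ◇₋ hm hn r _ = rel-irrelevant ◇₋ hm hn _ _ r
    minimal-∈-rel sat □₊ □₋ hm hn = minimal-∈-second □₊□₋ (isRel □₋ hn) (sat □₊□₋ hm hn)
    minimal-∈-rel sat □₋ □₊ hm hn = minimal-∈-second □₋□₊ (isRel □₊ hn) (sat □₋□₊ hm hn)
    minimal-∈-rel sat ◇₊ ◇₋ hm hn = minimal-∈-second ◇₊◇₋ (isRel ◇₋ hn) (sat ◇₊◇₋ hm hn)
    minimal-∈-rel sat ◇₋ ◇₊ hm hn = minimal-∈-second ◇₋◇₊ (isRel ◇₊ hn) (sat ◇₋◇₊ hm hn)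
    minimal-∈-rel sat □₊ ◇₋ hm hn = minimal-∈-second □₊◇₋ (isRel ◇₋ hn) (sat □₊◇₋ hm hn)
    minimal-∈-rel sat □₋ ◇₊ hm hn = minimal-∈-second □₋◇₊ (isRel ◇₊ hn) (sat □₋◇₊ hm hn)
    minimal-∈-rel sat ◇₊ □₋ hm hn = minimal-∈-second ◇₊□₋ (isRel □₋ hn) (sat ◇₊□₋ hm hn)
    minimal-∈-rel sat ◇₋ □₊ hm hn = minimal-∈-second ◇₋□₊ (isRel □₊ hn) (sat ◇₋□₊ hm hn)
    minimal-∈-rel sat □₊ ◇₊ hm hn = minimal-∈-second □₊◇₊ (isRel ◇₊ hn) (sat □₊◇₊ hm hn)
    minimal-∈-rel sat □₋ ◇₋ hm hn = minimal-∈-second □₋◇₋ (isRel ◇₋ hn) (sat □₋◇₋ hm hn)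
    minimal-∈-rel sat ◇₊ □₊ hm hn = minimal-∈-second ◇₊□₊ (isRel □₊ hn) (sat ◇₊□₊ hm hn)
    minimal-∈-rel sat ◇₋ □₋ hm hn = minimal-∈-second ◇₋□₋ (isRel □₋ hn) (sat ◇₋□₋ hm hn)

    ⋂rel : Rel W ℓ
    ⋂rel x y = ∀ m (h : T (L m)) → rel m h x y

    conditions⇒unimodal : MinimallyGenerated F → SatisfiesAllConditions F → Unimodal F
    conditions⇒unimodal minGen sat = ⋂rel , λ m h →
        minGen-⊆-image m (minGen m h) (λ r min n hn → minimal-∈-rel sat m n h hn r min)
      , image-⊆ m (isRel m h) (λ x y ⋂rel-xy → ⋂rel-xy m h)

mainTheorem3 : ∀ {c ℓ₁ ℓ₂ ℓ} (P : Poset c ℓ₁ ℓ₂) (L : Signature)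
    (F : OnPoset.Frame P L ℓ) → OnPoset.MinimallyGenerated P F →
    (OnPoset.Unimodal P F ⇔ OnPoset.SatisfiesAllConditions P F)
mainTheorem3 P L F minGen =
  mk⇔ (unimodal⇒conditions P F) (conditions⇒unimodal P F minGen)
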